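{- For every odd prime $p$, \[ \sum_{i=0}^{p-1}\sum_{j=0}^{p-1}S(i,j)\equiv \left(\frac{p}{3}\right)\pmod{p}, \] where $S(i,j)=\dfrac{\binom{2i}{i}\binom{2j}{j}}{\binom{i+j}{i}}$.
   Context: The numbers $S(m,n)=\binom{2m}{m}\binom{2n}{n}/\binom{m+n}{m}$ (for non-negative integers $m,n$) are the super Catalan numbers; they are integers. $\left(\frac{\cdot}{3}\right)$ denotes the Legendre symbol modulo $3$ (so $\left(\frac{p}{3}\right)=1$ if $p\equiv1\pmod 3$, $-1$ if $p\equiv 2\pmod 3$, and $0$ if $p=3$). -}

module Defs where

open import Data.Nat using (ℕ; zero; suc; _+_; _*_; _%_; _≤_; _<_; z≤n; s≤s; NonZero; >-nonZero)
open import Data.Nat.Combinatorics using (_C_; nCk+nC[k+1]≡[n+1]C[k+1])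
open import Data.Nat.Properties using (m≤m+n; ≤-trans; ≤-reflexive)
open import Data.Nat.DivMod using (_/_)
open import Data.Integer using (ℤ; +_; -_)
open import Relation.Binary.PropositionalEquality using (_≡_; refl)

-- positivity of binomial coefficients (helper, so that division below is legal)
nCk-pos : ∀ n k → k ≤ n → 0 < n C k
nCk-pos n zero _ = s≤s z≤n
nCk-pos (suc n) (suc k) (s≤s k≤n) =
  ≤-trans (≤-trans (nCk-pos n k k≤n) (m≤m+n (n C k) (n C (suc k))))
          (≤-reflexive (nCk+nC[k+1]≡[n+1]C[k+1] n k))

binom-nonzero : ∀ i j → NonZero ((i + j) C i)
binom-nonzero i j = >-nonZero (nCk-pos (i + j) i (m≤m+n i j))

-- super Catalan number S(m,n) = C(2m,m) C(2n,n) / C(m+n,m)  (exact division)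
S : ℕ → ℕ → ℕ
S m n = (((2 * m) C m) * ((2 * n) C n)) / ((m + n) C m)
  where instance _ = binom-nonzero m n

Σ< : ℕ → (ℕ → ℕ) → ℕ
Σ< zero f = 0
Σ< (suc n) f = Σ< n f + f n

legendre3 : ℕ → ℤ
legendre3 p with p % 3
... | 0 = + 0
... | 1 = + 1
... | _ = - (+ 1)

module Submission where

-- The sum Σ_{i,j<p} S(i,j) is evaluated modulo p through von Szily's identity
--   S(m,n) = Σ_{k ∈ ℤ} (-1)^k C(2m,m+k) C(2n,n+k).
-- Write c(m,k) = C(2m,m+k) and A(n,k) = Σ_{i<n} c(i,k).  Grouping the terms ±k
-- (weight w_0 = 1, w_k = 2 for k > 0), the double sum separates into
--   Σ_{i,j<p} S(i,j) = Σ_{k<p} w_k (-1)^k A(p,k)².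
-- Modulo p the column sums are periodic: A(p,k) + A(p,k+1) + A(p,k+2) = c(p,k+1)
-- telescopes, c(p,k+1) ≡ 0 for k+1 < p, and A(p,p) = 0, A(p,p-1) = 1, so
-- A(p,k) ≡ χ(p-k) for the character χ of period 3 with values 0, 1, -1.
-- Finally Σ_{k<n} w_k (-1)^k χ(n-k)² = χ(n), and χ(p) = (p/3).

open import Defs

module CentralBinomial where

  open import Data.Nat
  open import Data.Nat.Properties
  open import Data.Nat.Combinatorics
    using (_C_; nCk+nC[k+1]≡[n+1]C[k+1]; nCk≡nC[n∸k]; nCn≡1; nC1≡n; k>n⇒nCk≡0)
  open import Data.Nat.Divisibility
    using (_∣_; ∣m+n∣m⇒∣n; ∣⇒≤; ∣-refl; ∣-trans; n∣m*n; m∣m*n)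
  open import Data.Nat.Primality using (Prime; euclidsLemma)
  open import Data.Nat.Tactic.RingSolver using (solve-∀)
  open import Data.Sum using (inj₁; inj₂)
  open import Relation.Nullary using (contradiction)
  open import Relation.Binary.PropositionalEquality
  open ≡-Reasoning

  pascal : ∀ n k → suc n C suc k ≡ n C k + n C suc k
  pascal n k = sym (nCk+nC[k+1]≡[n+1]C[k+1] n k)

  absorption : ∀ n k → suc k * (suc n C suc k) ≡ suc n * (n C k)
  absorption zero zero = refl
  absorption zero (suc k) = *-zeroʳ (suc (suc k))
  absorption (suc n) zero =
    trans (+-identityʳ _) (trans (nC1≡n (suc (suc n))) (sym (*-identityʳ _)))
  absorption (suc n) (suc k) = begin
    (2 + k) * (suc (suc n) C suc (suc k))         ≡⟨ cong ((2 + k) *_) (pascal (suc n) (suc k)) ⟩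
    (2 + k) * (X + Y)                             ≡⟨ regroup k X Y ⟩
    (1 + k) * X + X + (2 + k) * Y                 ≡⟨ cong₂ (λ u v → u + X + v) (absorption n k) (absorption n (suc k)) ⟩
    (1 + n) * (n C k) + X + (1 + n) * (n C suc k) ≡⟨ collect n (n C k) (n C suc k) X ⟩
    (1 + n) * (n C k + n C suc k) + X             ≡⟨ cong (λ u → (1 + n) * u + X) (sym (pascal n k)) ⟩
    (1 + n) * X + X                               ≡⟨ +-comm ((1 + n) * X) X ⟩
    (2 + n) * X                                   ∎
    where
    X Y : ℕ
    X = suc n C suc k
    Y = suc n C suc (suc k)
    regroup : ∀ k X Y → (2 + k) * (X + Y) ≡ (1 + k) * X + X + (2 + k) * Y
    regroup = solve-∀
    collect : ∀ n a b X → (1 + n) * a + X + (1 + n) * b ≡ (1 + n) * (a + b) + X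
    collect = solve-∀

  binom-sym : ∀ a b → (a + b) C a ≡ (a + b) C b
  binom-sym a b = trans (nCk≡nC[n∸k] (m≤m+n a b)) (cong ((a + b) C_) (m+n∸m≡n a b))

  binom-shift : ∀ m n → suc n * ((m + suc n) C m) ≡ suc (m + n) * ((m + n) C m)
  binom-shift m n = begin
    suc n * ((m + suc n) C m)       ≡⟨ cong (suc n *_) (binom-sym m (suc n)) ⟩
    suc n * ((m + suc n) C suc n)   ≡⟨ cong (λ u → suc n * (u C suc n)) (+-suc m n) ⟩
    suc n * (suc (m + n) C suc n)   ≡⟨ absorption (m + n) n ⟩
    suc (m + n) * ((m + n) C n)     ≡⟨ cong (suc (m + n) *_) (binom-sym m n) ⟨
    suc (m + n) * ((m + n) C m)     ∎

  ctr : ℕ → ℕ → ℕ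
  ctr m k = (2 * m) C (m + k)

  two-suc : ∀ m → 2 * suc m ≡ suc (suc (2 * m))
  two-suc m = *-suc 2 m

  ctr-pascal : ∀ m k → ctr (suc m) (suc k) ≡ ctr m k + 2 * ctr m (suc k) + ctr m (suc (suc k))
  ctr-pascal m k = begin
    (2 * suc m) C (suc m + suc k)
      ≡⟨ cong₂ _C_ (two-suc m) (cong suc (+-suc m k)) ⟩
    suc (suc (2 * m)) C suc (suc (m + k))
      ≡⟨ pascal (suc (2 * m)) (suc (m + k)) ⟩
    suc (2 * m) C suc (m + k) + suc (2 * m) C suc (suc (m + k))
      ≡⟨ cong₂ _+_ (pascal (2 * m) (m + k)) (pascal (2 * m) (suc (m + k))) ⟩
    a + b + (b + d)
      ≡⟨ regroup a b d ⟩
    a + 2 * b + d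
      ≡⟨ cong₂ (λ u v → a + 2 * ((2 * m) C u) + (2 * m) C v) (sym (+-suc m k))
               (trans (cong suc (sym (+-suc m k))) (sym (+-suc m (suc k)))) ⟩
    ctr m k + 2 * ctr m (suc k) + ctr m (suc (suc k)) ∎
    where
    a b d : ℕ
    a = (2 * m) C (m + k)
    b = (2 * m) C suc (m + k)
    d = (2 * m) C suc (suc (m + k))
    regroup : ∀ a b d → a + b + (b + d) ≡ a + 2 * b + d
    regroup = solve-∀

  ctr-zero-one : ∀ m → ctr m 0 + ctr m 1 ≡ suc (2 * m) C suc m
  ctr-zero-one m =
    trans (cong₂ _+_ (cong ((2 * m) C_) (+-identityʳ m)) (cong ((2 * m) C_) (+-comm m 1)))
          (sym (pascal (2 * m) m))

  ctr-succ-zero : ∀ m → ctr (suc m) 0 ≡ 2 * (suc (2 * m) C suc m)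
  ctr-succ-zero m = begin
    (2 * suc m) C (suc m + 0)              ≡⟨ cong₂ _C_ (two-suc m) (cong suc (+-identityʳ m)) ⟩
    suc (suc (2 * m)) C suc m              ≡⟨ pascal (suc (2 * m)) m ⟩
    suc (2 * m) C m + suc (2 * m) C suc m  ≡⟨ cong (_+ suc (2 * m) C suc m) middle-sym ⟩
    suc (2 * m) C suc m + suc (2 * m) C suc m ≡⟨ cong (suc (2 * m) C suc m +_) (+-identityʳ _) ⟨
    2 * (suc (2 * m) C suc m)              ∎
    where
    row : suc (2 * m) ≡ m + suc m
    row = trans (cong suc (cong (m +_) (+-identityʳ m))) (sym (+-suc m m))
    middle-sym : suc (2 * m) C m ≡ suc (2 * m) C suc m
    middle-sym = subst (λ r → r C m ≡ r C suc m) (sym row) (binom-sym m (suc m))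

  ctr-zero : ∀ m → ctr (suc m) 0 ≡ 2 * (ctr m 0 + ctr m 1)
  ctr-zero m = trans (ctr-succ-zero m) (cong (2 *_) (sym (ctr-zero-one m)))

  ctr-central : ∀ m → suc m * ctr (suc m) 0 ≡ 2 * suc (2 * m) * ctr m 0
  ctr-central m = begin
    suc m * ctr (suc m) 0                  ≡⟨ cong (suc m *_) (ctr-succ-zero m) ⟩
    suc m * (2 * (suc (2 * m) C suc m))    ≡⟨ x*[2*y]≡2*[x*y] (suc m) (suc (2 * m) C suc m) ⟩
    2 * (suc m * (suc (2 * m) C suc m))    ≡⟨ cong (2 *_) (absorption (2 * m) m) ⟩
    2 * (suc (2 * m) * ((2 * m) C m))      ≡⟨ *-assoc 2 (suc (2 * m)) ((2 * m) C m) ⟨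
    2 * suc (2 * m) * ((2 * m) C m)        ≡⟨ cong (λ u → 2 * suc (2 * m) * ((2 * m) C u)) (+-identityʳ m) ⟨
    2 * suc (2 * m) * ctr m 0              ∎
    where
    x*[2*y]≡2*[x*y] : ∀ x y → x * (2 * y) ≡ 2 * (x * y)
    x*[2*y]≡2*[x*y] = solve-∀

  ctr-vanish : ∀ m k → m < k → ctr m k ≡ 0
  ctr-vanish m k m<k = k>n⇒nCk≡0 (subst (_< m + k) (sym (cong (m +_) (+-identityʳ m))) (+-monoʳ-< m m<k))

  ctr-diag : ∀ m → ctr m m ≡ 1
  ctr-diag m rewrite +-identityʳ m = nCn≡1 (m + m)

  -- For a prime p and 0 < k+1 < p, p ∣ c(p,k+1): from (p+k+1)·c(p,k+1) = 2p·C(2p-1,p+k)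
  -- and p ∤ p+k+1.
  prime-∣-ctr : ∀ p k → Prime p → suc k < p → p ∣ ctr p (suc k)
  prime-∣-ctr p@(suc q) k p-prime k+1<p with euclidsLemma (suc (p + k)) (ctr p (suc k)) p-prime p∣product
    where
    product-eq : suc (p + k) * ctr p (suc k) ≡ 2 * p * (suc (2 * q) C (p + k))
    product-eq = begin
      suc (p + k) * ((2 * p) C (p + suc k))            ≡⟨ cong (λ u → suc (p + k) * ((2 * p) C u)) (+-suc p k) ⟩
      suc (p + k) * ((2 * p) C suc (p + k))            ≡⟨ cong (λ u → suc (p + k) * (u C suc (p + k))) (two-suc q) ⟩
      suc (p + k) * (suc (suc (2 * q)) C suc (p + k))  ≡⟨ absorption (suc (2 * q)) (p + k) ⟩
      suc (suc (2 * q)) * (suc (2 * q) C (p + k))      ≡⟨ cong (_* (suc (2 * q) C (p + k))) (two-suc q) ⟨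
      2 * p * (suc (2 * q) C (p + k))                  ∎
    p∣product : p ∣ suc (p + k) * ctr p (suc k)
    p∣product = subst (p ∣_) (sym product-eq)
      (subst (p ∣_) (sym (*-assoc 2 p _)) (∣-trans (m∣m*n (suc (2 * q) C (p + k))) (n∣m*n 2)))
  ... | inj₂ p∣ctr = p∣ctr
  ... | inj₁ p∣p+k+1 = contradiction (∣⇒≤ (∣m+n∣m⇒∣n (subst (p ∣_) (sym (+-suc p k)) p∣p+k+1) ∣-refl))
                                      (<⇒≱ k+1<p)

  column : ℕ → ℕ → ℕ
  column n k = Σ< n (λ i → ctr i k)

  -- Telescoping: by ctr-pascal each summand is c(i+1,k+1) - c(i,k+1).
  column-three-term : ∀ n k → column n k + column n (suc k) + column n (suc (suc k)) ≡ ctr n (suc k)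
  column-three-term zero k = refl
  column-three-term (suc n) k = begin
    (A₀ + a₀) + (A₁ + a₁) + (A₂ + a₂)   ≡⟨ interchange A₀ a₀ A₁ a₁ A₂ a₂ ⟩
    (A₀ + A₁ + A₂) + (a₀ + a₁ + a₂)     ≡⟨ cong (_+ (a₀ + a₁ + a₂)) (column-three-term n k) ⟩
    a₁ + (a₀ + a₁ + a₂)                 ≡⟨ absorb-middle a₁ a₀ a₂ ⟩
    a₀ + 2 * a₁ + a₂                    ≡⟨ ctr-pascal n k ⟨
    ctr (suc n) (suc k)                 ∎
    where
    A₀ A₁ A₂ a₀ a₁ a₂ : ℕ
    A₀ = column n k
    A₁ = column n (suc k)
    A₂ = column n (suc (suc k))
    a₀ = ctr n k
    a₁ = ctr n (suc k)
    a₂ = ctr n (suc (suc k))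
    interchange : ∀ a x b y d z → a + x + (b + y) + (d + z) ≡ a + b + d + (x + y + z)
    interchange = solve-∀
    absorb-middle : ∀ b x z → b + (x + b + z) ≡ x + 2 * b + z
    absorb-middle = solve-∀

  column-vanish : ∀ n k → n ≤ k → column n k ≡ 0
  column-vanish zero k _ = refl
  column-vanish (suc n) k n<k =
    cong₂ _+_ (column-vanish n k (≤-trans (n≤1+n n) n<k)) (ctr-vanish n k n<k)

  -- The last nonzero column: A(k+1,k) = 1, since c(k+1,k+1) = 1 and later columns vanish.
  column-last : ∀ k → column (suc k) k ≡ 1
  column-last k = begin
    column (suc k) k                                         ≡⟨ +-identityʳ _ ⟨
    column (suc k) k + 0                                     ≡⟨ +-identityʳ _ ⟨
    column (suc k) k + 0 + 0                                 ≡⟨ cong₂ (λ u v → column (suc k) k + u + v)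
                                                                  (column-vanish (suc k) (suc k) ≤-refl)
                                                                  (column-vanish (suc k) (suc (suc k)) (n≤1+n (suc k))) ⟨
    column (suc k) k + column (suc k) (suc k) + column (suc k) (suc (suc k)) ≡⟨ column-three-term (suc k) k ⟩
    ctr (suc k) (suc k)                                      ≡⟨ ctr-diag (suc k) ⟩
    1                                                        ∎

module IntegerSums where

  open import Data.Nat using (ℕ; zero; suc; _<_)
  open import Data.Nat.Properties using (m<n⇒m<1+n; ≤-refl)
  open import Data.Integer using (ℤ; +_; _+_; _*_)
  open import Data.Integer.Properties using (pos-+; *-comm; *-assoc; *-distribˡ-+; *-zeroʳ; +-assoc)
  open import Data.Integer.Tactic.RingSolver using (solve-∀)
  open import Relation.Binary.PropositionalEquality
  open ≡-Reasoning

  Σℤ : ℕ → (ℕ → ℤ) → ℤ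
  Σℤ zero f = + 0
  Σℤ (suc n) f = Σℤ n f + f n

  Σℤ-cast : ∀ n f → + Σ< n f ≡ Σℤ n (λ i → + f i)
  Σℤ-cast zero f = refl
  Σℤ-cast (suc n) f = trans (pos-+ (Σ< n f) (f n)) (cong (_+ + f n) (Σℤ-cast n f))

  Σℤ-cong : ∀ n {f g : ℕ → ℤ} → (∀ i → i < n → f i ≡ g i) → Σℤ n f ≡ Σℤ n g
  Σℤ-cong zero eq = refl
  Σℤ-cong (suc n) eq = cong₂ _+_ (Σℤ-cong n (λ i i<n → eq i (m<n⇒m<1+n i<n))) (eq n ≤-refl)

  Σℤ-+ : ∀ n (f g : ℕ → ℤ) → Σℤ n (λ i → f i + g i) ≡ Σℤ n f + Σℤ n g
  Σℤ-+ zero f g = refl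
  Σℤ-+ (suc n) f g = trans (cong (_+ (f n + g n)) (Σℤ-+ n f g)) (interchange (Σℤ n f) (Σℤ n g) (f n) (g n))
    where
    interchange : ∀ a b x y → (a + b) + (x + y) ≡ (a + x) + (b + y)
    interchange = solve-∀

  Σℤ-zero : ∀ n → Σℤ n (λ _ → + 0) ≡ + 0
  Σℤ-zero zero = refl
  Σℤ-zero (suc n) = cong (_+ + 0) (Σℤ-zero n)

  Σℤ-swap : ∀ n m (f : ℕ → ℕ → ℤ) → Σℤ n (λ i → Σℤ m (f i)) ≡ Σℤ m (λ j → Σℤ n (λ i → f i j))
  Σℤ-swap zero m f = sym (Σℤ-zero m)
  Σℤ-swap (suc n) m f =
    trans (cong (_+ Σℤ m (f n)) (Σℤ-swap n m f)) (sym (Σℤ-+ m (λ j → Σℤ n (λ i → f i j)) (f n)))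

  Σℤ-*ˡ : ∀ n x (f : ℕ → ℤ) → Σℤ n (λ i → x * f i) ≡ x * Σℤ n f
  Σℤ-*ˡ zero x f = sym (*-zeroʳ x)
  Σℤ-*ˡ (suc n) x f = trans (cong (_+ x * f n) (Σℤ-*ˡ n x f)) (sym (*-distribˡ-+ x (Σℤ n f) (f n)))

  Σℤ-shift : ∀ n (f : ℕ → ℤ) → Σℤ (suc n) f ≡ f 0 + Σℤ n (λ k → f (suc k))
  Σℤ-shift zero f = solve-∀-s (f 0)
    where
    solve-∀-s : ∀ x → + 0 + x ≡ x + + 0
    solve-∀-s = solve-∀
  Σℤ-shift (suc n) f = trans (cong (_+ f (suc n)) (Σℤ-shift n f)) (+-assoc (f 0) _ (f (suc n)))

  Σℤ-*ʳ : ∀ n x (f : ℕ → ℤ) → Σℤ n (λ i → f i * x) ≡ Σℤ n f * x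
  Σℤ-*ʳ n x f = begin
    Σℤ n (λ i → f i * x)  ≡⟨ Σℤ-cong n (λ i _ → *-comm (f i) x) ⟩
    Σℤ n (λ i → x * f i)  ≡⟨ Σℤ-*ˡ n x f ⟩
    x * Σℤ n f            ≡⟨ *-comm x (Σℤ n f) ⟩
    Σℤ n f * x            ∎

  Σℤ-separate : ∀ n B (e : ℕ → ℤ) (f g : ℕ → ℕ → ℤ) →
    Σℤ n (λ i → Σℤ n (λ j → Σℤ B (λ k → e k * (f i k * g j k))))
      ≡ Σℤ B (λ k → e k * Σℤ n (λ i → f i k) * Σℤ n (λ j → g j k))
  Σℤ-separate n B e f g = begin
    Σℤ n (λ i → Σℤ n (λ j → Σℤ B (λ k → t i j k)))
      ≡⟨ Σℤ-cong n (λ i _ → Σℤ-swap n B (t i)) ⟩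
    Σℤ n (λ i → Σℤ B (λ k → Σℤ n (λ j → t i j k)))
      ≡⟨ Σℤ-swap n B (λ i k → Σℤ n (λ j → t i j k)) ⟩
    Σℤ B (λ k → Σℤ n (λ i → Σℤ n (λ j → t i j k)))
      ≡⟨ Σℤ-cong B (λ k _ → Σℤ-cong n (λ i _ → factor-j k i)) ⟩
    Σℤ B (λ k → Σℤ n (λ i → (e k * f i k) * G k))
      ≡⟨ Σℤ-cong B (λ k _ → trans (Σℤ-*ʳ n (G k) (λ i → e k * f i k))
                                  (cong (_* G k) (Σℤ-*ˡ n (e k) (λ i → f i k)))) ⟩
    Σℤ B (λ k → e k * F k * G k) ∎
    where
    t : ℕ → ℕ → ℕ → ℤ
    t i j k = e k * (f i k * g j k)
    F G : ℕ → ℤ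
    F k = Σℤ n (λ i → f i k)
    G k = Σℤ n (λ j → g j k)
    factor-j : ∀ k i → Σℤ n (λ j → t i j k) ≡ (e k * f i k) * G k
    factor-j k i = trans (Σℤ-cong n (λ j _ → sym (*-assoc (e k) (f i k) (g j k))))
                         (Σℤ-*ˡ n (e k * f i k) (λ j → g j k))

module VonSzily where

  open CentralBinomial
  open IntegerSums
  open import Data.Nat as ℕ using (ℕ; zero; suc; _<_; s≤s; NonZero)
  import Data.Nat.Properties as ℕₚ
  open import Data.Nat.Combinatorics using (_C_; nCn≡1)
  open import Data.Nat.DivMod using (_/_; m*n/n≡m)
  open import Data.Integer using (ℤ; +_; -_; _+_; _*_; _-_; -[1+_])
  open import Data.Integer.Properties using (pos-+; pos-*; +-injective; *-cancelˡ-≡; *-zeroʳ; +-identityʳ)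
  open import Data.Integer.Tactic.RingSolver using (solve-∀; solve)
  open import Data.List using (_∷_; [])
  open import Relation.Binary.PropositionalEquality
  open ≡-Reasoning

  sign : ℕ → ℤ
  sign zero = + 1
  sign (suc k) = - sign k

  -- The number of integers k′ with |k′| = k.
  weight : ℕ → ℤ
  weight zero = + 1
  weight (suc _) = + 2

  -- szily B m n = Σ_{|k| < B} (-1)^k c(m,k) c(n,k); it is independent of B once B > m.
  szily : ℕ → ℕ → ℕ → ℤ
  szily B m n = Σℤ B (λ k → weight k * sign k * (+ ctr m k * + ctr n k))

  ctr-pascalℤ : ∀ m k → + ctr (suc m) (suc k) ≡ + ctr m k + + 2 * + ctr m (suc k) + + ctr m (suc (suc k))
  ctr-pascalℤ m k = begin
    + ctr (suc m) (suc k)                           ≡⟨ cong +_ (ctr-pascal m k) ⟩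
    + (a ℕ.+ 2 ℕ.* b ℕ.+ d)                         ≡⟨ pos-+ (a ℕ.+ 2 ℕ.* b) d ⟩
    + (a ℕ.+ 2 ℕ.* b) + + d                         ≡⟨ cong (_+ + d) (pos-+ a (2 ℕ.* b)) ⟩
    + a + + (2 ℕ.* b) + + d                         ≡⟨ cong (λ z → + a + z + + d) (pos-* 2 b) ⟩
    + a + + 2 * + b + + d                           ∎
    where
    a b d : ℕ
    a = ctr m k
    b = ctr m (suc k)
    d = ctr m (suc (suc k))

  ctr-zeroℤ : ∀ m → + ctr (suc m) 0 ≡ + 2 * (+ ctr m 0 + + ctr m 1)
  ctr-zeroℤ m = trans (cong +_ (ctr-zero m))
    (trans (pos-* 2 (ctr m 0 ℕ.+ ctr m 1)) (cong (+ 2 *_) (pos-+ (ctr m 0) (ctr m 1))))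

  cast-product : ∀ a b d e → a ℕ.* b ≡ d ℕ.* e → + a * + b ≡ + d * + e
  cast-product a b d e eq = trans (sym (pos-* a b)) (trans (cong +_ eq) (pos-* d e))

  ctr-centralℤ : ∀ m → + suc m * + ctr (suc m) 0 ≡ + 2 * (+ 1 + + 2 * + m) * + ctr m 0
  ctr-centralℤ m = trans (cast-product (suc m) (ctr (suc m) 0) (2 ℕ.* suc (2 ℕ.* m)) (ctr m 0) (ctr-central m))
    (cong (_* + ctr m 0) (trans (pos-* 2 (suc (2 ℕ.* m))) (cong (λ z → + 2 * (+ 1 + z)) (pos-* 2 m))))

  -- The boundary term left over by the recurrence below.
  defect : ℕ → ℕ → ℕ → ℤ
  defect m n k = + ctr m k * + ctr n (suc k) + + ctr m (suc k) * + ctr n k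

  -- Contribution of k = 0: substituting c(m+1,0) = 2(a₀+a₁), c(n+1,0) = 2(b₀+b₁).
  defect-base-identity : ∀ a₀ a₁ b₀ b₁ A B → A ≡ + 2 * (a₀ + a₁) → B ≡ + 2 * (b₀ + b₁) →
    (+ 0 + + 1 * + 1 * (A * b₀)) + (+ 0 + + 1 * + 1 * (a₀ * B)) - + 4 * (+ 0 + + 1 * + 1 * (a₀ * b₀))
      ≡ + 2 * + 1 * (a₀ * b₁ + a₁ * b₀)
  defect-base-identity a₀ a₁ b₀ b₁ _ _ refl refl = identity a₀ a₁ b₀ b₁
    where
    identity : ∀ a₀ a₁ b₀ b₁ →
      (+ 0 + + 1 * + 1 * (+ 2 * (a₀ + a₁) * b₀)) + (+ 0 + + 1 * + 1 * (a₀ * (+ 2 * (b₀ + b₁))))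
        - + 4 * (+ 0 + + 1 * + 1 * (a₀ * b₀)) ≡ + 2 * + 1 * (a₀ * b₁ + a₁ * b₀)
    identity = solve-∀

  -- Adding the term k+1 (weight -2s) with c(m+1,k+1) = a₀+2a₁+a₂, c(n+1,k+1) = b₀+2b₁+b₂
  -- turns the boundary term 2s·D(k) into -2s·D(k+1).
  defect-step-identity : ∀ s a₀ a₁ a₂ b₀ b₁ b₂ A B W₁₀ W₀₁ W₀₀ → A ≡ a₀ + + 2 * a₁ + a₂ → B ≡ b₀ + + 2 * b₁ + b₂ →
    W₁₀ + W₀₁ - + 4 * W₀₀ ≡ + 2 * s * (a₀ * b₁ + a₁ * b₀) →
    (W₁₀ + + 2 * (- s) * (A * b₁)) + (W₀₁ + + 2 * (- s) * (a₁ * B)) - + 4 * (W₀₀ + + 2 * (- s) * (a₁ * b₁))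
      ≡ + 2 * (- s) * (a₁ * b₂ + a₂ * b₁)
  defect-step-identity s a₀ a₁ a₂ b₀ b₁ b₂ _ _ W₁₀ W₀₁ W₀₀ refl refl ih = begin
    (W₁₀ + + 2 * (- s) * ((a₀ + + 2 * a₁ + a₂) * b₁)) + (W₀₁ + + 2 * (- s) * (a₁ * (b₀ + + 2 * b₁ + b₂)))
      - + 4 * (W₀₀ + + 2 * (- s) * (a₁ * b₁))
        ≡⟨ solve (s ∷ a₀ ∷ a₁ ∷ a₂ ∷ b₀ ∷ b₁ ∷ b₂ ∷ W₁₀ ∷ W₀₁ ∷ W₀₀ ∷ []) ⟩
    (W₁₀ + W₀₁ - + 4 * W₀₀) - + 2 * s * (a₀ * b₁ + a₁ * b₀) + + 2 * (- s) * (a₁ * b₂ + a₂ * b₁)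
        ≡⟨ cong (λ x → x - + 2 * s * (a₀ * b₁ + a₁ * b₀) + + 2 * (- s) * (a₁ * b₂ + a₂ * b₁)) ih ⟩
    + 2 * s * (a₀ * b₁ + a₁ * b₀) - + 2 * s * (a₀ * b₁ + a₁ * b₀) + + 2 * (- s) * (a₁ * b₂ + a₂ * b₁)
        ≡⟨ solve (s ∷ a₀ ∷ a₁ ∷ a₂ ∷ b₀ ∷ b₁ ∷ b₂ ∷ []) ⟩
    + 2 * (- s) * (a₁ * b₂ + a₂ * b₁) ∎

  -- szily fails 4S(m,n) = S(m+1,n) + S(m,n+1) only by a boundary term at k = B.
  szily-defect : ∀ B m n →
    szily (suc B) (suc m) n + szily (suc B) m (suc n) - + 4 * szily (suc B) m n ≡ + 2 * sign B * defect m n B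
  szily-defect zero m n =
    defect-base-identity (+ ctr m 0) (+ ctr m 1) (+ ctr n 0) (+ ctr n 1)
      (+ ctr (suc m) 0) (+ ctr (suc n) 0) (ctr-zeroℤ m) (ctr-zeroℤ n)
  szily-defect (suc B) m n =
    defect-step-identity (sign B) (+ ctr m B) (+ ctr m (suc B)) (+ ctr m (suc (suc B)))
      (+ ctr n B) (+ ctr n (suc B)) (+ ctr n (suc (suc B)))
      (+ ctr (suc m) (suc B)) (+ ctr (suc n) (suc B))
      (szily (suc B) (suc m) n) (szily (suc B) m (suc n)) (szily (suc B) m n)
      (ctr-pascalℤ m B) (ctr-pascalℤ n B) (szily-defect B m n)

  solve-for-second : ∀ x y z → x + y - + 4 * z ≡ + 0 → y ≡ + 4 * z - x
  solve-for-second x y z eq = begin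
    y                                  ≡⟨ solve (x ∷ y ∷ z ∷ []) ⟩
    + 4 * z - x + (x + y - + 4 * z)    ≡⟨ cong (λ t → + 4 * z - x + t) eq ⟩
    + 4 * z - x + + 0                  ≡⟨ solve (x ∷ z ∷ []) ⟩
    + 4 * z - x                        ∎

  szily-recurrence : ∀ B m n → m < B →
    szily (suc B) m (suc n) ≡ + 4 * szily (suc B) m n - szily (suc B) (suc m) n
  szily-recurrence B m n m<B = solve-for-second (szily (suc B) (suc m) n) (szily (suc B) m (suc n)) (szily (suc B) m n)
      (trans (szily-defect B m n) boundary-vanishes)
    where
    boundary-vanishes : + 2 * sign B * defect m n B ≡ + 0
    boundary-vanishes rewrite ctr-vanish m B m<B | ctr-vanish m (suc B) (ℕₚ.m<n⇒m<1+n m<B) =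
      *-zeroʳ (+ 2 * sign B)

  szily-extend : ∀ B m n → m < B → szily (suc B) m n ≡ szily B m n
  szily-extend B m n m<B rewrite ctr-vanish m B m<B =
    trans (cong (λ t → szily B m n + t) (*-zeroʳ (weight B * sign B))) (+-identityʳ (szily B m n))

  -- For n = 0 only the term k = 0 survives, as c(0,k) = 0 for k > 0.
  szily-zero : ∀ B m → szily (suc B) m 0 ≡ + ctr m 0
  szily-zero zero m = single-term (+ ctr m 0)
    where
    single-term : ∀ x → + 0 + + 1 * + 1 * (x * + 1) ≡ x
    single-term = solve-∀
  szily-zero (suc B) m =
    trans (cong (λ t → szily (suc B) m 0 + t) last-term-vanishes)
          (trans (+-identityʳ (szily (suc B) m 0)) (szily-zero B m))
    where
    last-term-vanishes : weight (suc B) * sign (suc B) * (+ ctr m (suc B) * + 0) ≡ + 0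
    last-term-vanishes = trans (cong (weight (suc B) * sign (suc B) *_) (*-zeroʳ (+ ctr m (suc B))))
                               (*-zeroʳ (weight (suc B) * sign (suc B)))

  -- The super Catalan recurrence 4S(m,n) = S(m+1,n) + S(m,n+1), with the denominators
  -- X = C(m+n+1,m), Y = C(m+n,m), Z = C(m+n+1,m+1) cleared: if w₀₀ and w₁₀ equal S(m,n) and
  -- S(m+1,n) and w₀₁ = 4w₀₀ - w₁₀, then w₀₁ = S(m,n+1), up to the factor (m+1)(n+1).
  -- Here M = m, N = n, a = c(m,0), a′ = c(m+1,0), b = c(n,0), b′ = c(n+1,0).
  super-catalan-step : ∀ (M N a a′ b b′ w₀₀ w₁₀ w₀₁ X Y Z : ℤ) →
    w₀₁ ≡ + 4 * w₀₀ - w₁₀ →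
    (+ 1 + N) * X ≡ (+ 1 + (M + N)) * Y → (+ 1 + N) * X ≡ (+ 1 + M) * Z →
    w₀₀ * Y ≡ a * b → w₁₀ * Z ≡ a′ * b →
    (+ 1 + M) * a′ ≡ + 2 * (+ 1 + + 2 * M) * a →
    (+ 1 + N) * b′ ≡ + 2 * (+ 1 + + 2 * N) * b →
    (+ 1 + M) * ((+ 1 + N) * (w₀₁ * X)) ≡ (+ 1 + M) * ((+ 1 + N) * (a * b′))
  super-catalan-step M N a a′ b b′ w₀₀ w₁₀ w₀₁ X Y Z rec hY hZ ih₀ ih₁ ha hb = begin
    (+ 1 + M) * ((+ 1 + N) * (w₀₁ * X))
      ≡⟨ cong (λ w → (+ 1 + M) * ((+ 1 + N) * (w * X))) rec ⟩
    (+ 1 + M) * ((+ 1 + N) * ((+ 4 * w₀₀ - w₁₀) * X))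
      ≡⟨ solve (M ∷ N ∷ w₀₀ ∷ w₁₀ ∷ X ∷ []) ⟩
    + 4 * (+ 1 + M) * (w₀₀ * ((+ 1 + N) * X)) - (+ 1 + M) * (w₁₀ * ((+ 1 + N) * X))
      ≡⟨ cong₂ (λ u v → + 4 * (+ 1 + M) * (w₀₀ * u) - (+ 1 + M) * (w₁₀ * v)) hY hZ ⟩
    + 4 * (+ 1 + M) * (w₀₀ * ((+ 1 + (M + N)) * Y)) - (+ 1 + M) * (w₁₀ * ((+ 1 + M) * Z))
      ≡⟨ solve (M ∷ N ∷ w₀₀ ∷ w₁₀ ∷ Y ∷ Z ∷ []) ⟩
    + 4 * (+ 1 + M) * (+ 1 + (M + N)) * (w₀₀ * Y) - (+ 1 + M) * (+ 1 + M) * (w₁₀ * Z)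
      ≡⟨ cong₂ (λ u v → + 4 * (+ 1 + M) * (+ 1 + (M + N)) * u - (+ 1 + M) * (+ 1 + M) * v) ih₀ ih₁ ⟩
    + 4 * (+ 1 + M) * (+ 1 + (M + N)) * (a * b) - (+ 1 + M) * (+ 1 + M) * (a′ * b)
      ≡⟨ solve (M ∷ N ∷ a ∷ a′ ∷ b ∷ []) ⟩
    + 4 * (+ 1 + M) * (+ 1 + (M + N)) * (a * b) - (+ 1 + M) * (((+ 1 + M) * a′) * b)
      ≡⟨ cong (λ u → + 4 * (+ 1 + M) * (+ 1 + (M + N)) * (a * b) - (+ 1 + M) * (u * b)) ha ⟩
    + 4 * (+ 1 + M) * (+ 1 + (M + N)) * (a * b) - (+ 1 + M) * ((+ 2 * (+ 1 + + 2 * M) * a) * b)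
      ≡⟨ solve (M ∷ N ∷ a ∷ b ∷ []) ⟩
    (+ 1 + M) * (a * (+ 2 * (+ 1 + + 2 * N) * b))
      ≡⟨ cong (λ u → (+ 1 + M) * (a * u)) hb ⟨
    (+ 1 + M) * (a * ((+ 1 + N) * b′))
      ≡⟨ solve (M ∷ N ∷ a ∷ b′ ∷ []) ⟩
    (+ 1 + M) * ((+ 1 + N) * (a * b′)) ∎

  szily-product : ∀ n m B → m < B → szily B m n * + ((m ℕ.+ n) C m) ≡ + ctr m 0 * + ctr n 0
  szily-product zero m (suc B) _ = begin
    szily (suc B) m 0 * + ((m ℕ.+ 0) C m)  ≡⟨ cong₂ _*_ (szily-zero B m) (cong (λ r → + (r C m)) (ℕₚ.+-identityʳ m)) ⟩
    + ctr m 0 * + (m C m)                  ≡⟨ cong (λ x → + ctr m 0 * + x) (nCn≡1 m) ⟩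
    + ctr m 0 * + 1                        ∎
  szily-product (suc n) m B m<B = begin
    szily B m (suc n) * + X            ≡⟨ cong (_* + X) (szily-extend B m (suc n) m<B) ⟨
    szily (suc B) m (suc n) * + X      ≡⟨ *-cancelˡ-≡ (+ suc n) _ _ (*-cancelˡ-≡ (+ suc m) _ _ cleared) ⟩
    + ctr m 0 * + ctr (suc n) 0        ∎
    where
    X Y Z : ℕ
    X = (m ℕ.+ suc n) C m
    Y = (m ℕ.+ n) C m
    Z = (suc m ℕ.+ n) C suc m
    cleared : + suc m * (+ suc n * (szily (suc B) m (suc n) * + X))
                ≡ + suc m * (+ suc n * (+ ctr m 0 * + ctr (suc n) 0))
    cleared = super-catalan-step (+ m) (+ n)
      (+ ctr m 0) (+ ctr (suc m) 0) (+ ctr n 0) (+ ctr (suc n) 0)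
      (szily (suc B) m n) (szily (suc B) (suc m) n) (szily (suc B) m (suc n)) (+ X) (+ Y) (+ Z)
      (szily-recurrence B m n m<B)
      (cast-product (suc n) X (suc (m ℕ.+ n)) Y (binom-shift m n))
      (cast-product (suc n) X (suc m) Z (trans (binom-shift m n) (sym (absorption (m ℕ.+ n) m))))
      (szily-product n m (suc B) (ℕₚ.m<n⇒m<1+n m<B))
      (szily-product n (suc m) (suc B) (s≤s m<B))
      (ctr-centralℤ m) (ctr-centralℤ n)

  exact-quotient : ∀ (w : ℤ) (a y : ℕ) .{{_ : NonZero y}} → w * + y ≡ + a → + (a / y) ≡ w
  exact-quotient (+ x) a y eq = cong +_ (trans (cong (_/ y) (sym (+-injective (trans (pos-* x y) eq)))) (m*n/n≡m x y))
  exact-quotient -[1+ x ] a (suc y) ()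

  super-catalan-szily : ∀ m n B → m < B → + S m n ≡ szily B m n
  super-catalan-szily m n B m<B = exact-quotient (szily B m n) _ _ {{binom-nonzero m n}} (begin
    szily B m n * + ((m ℕ.+ n) C m)      ≡⟨ szily-product n m B m<B ⟩
    + ctr m 0 * + ctr n 0                ≡⟨ cong₂ (λ u v → + ((2 ℕ.* m) C u) * + ((2 ℕ.* n) C v)) (ℕₚ.+-identityʳ m) (ℕₚ.+-identityʳ n) ⟩
    + ((2 ℕ.* m) C m) * + ((2 ℕ.* n) C n) ≡⟨ pos-* ((2 ℕ.* m) C m) ((2 ℕ.* n) C n) ⟨
    + (((2 ℕ.* m) C m) ℕ.* ((2 ℕ.* n) C n)) ∎)

module CubicCharacter where

  open VonSzily using (sign; weight)
  open IntegerSums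
  open import Data.Nat using (ℕ; zero; suc; _∸_; _<_; s≤s)
  open import Data.Nat.Properties using (+-comm)
  open import Data.Nat.DivMod using (_%_; m%n<n; [m+n]%n≡m%n)
  open import Data.Integer using (ℤ; +_; -_; _+_; _*_; _-_)
  open import Data.Integer.Tactic.RingSolver using (solve-∀)
  open import Relation.Binary.PropositionalEquality
  open ≡-Reasoning

  χ : ℕ → ℤ
  χ 0 = + 0
  χ 1 = + 1
  χ 2 = - + 1
  χ (suc (suc (suc n))) = χ n

  χ-recurrence : ∀ n → χ (suc (suc n)) ≡ - χ (suc n) - χ n
  χ-recurrence 0 = refl
  χ-recurrence 1 = refl
  χ-recurrence 2 = refl
  χ-recurrence (suc (suc (suc n))) = χ-recurrence n

  χ-residue : ∀ n → χ n ≡ χ (n % 3)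
  χ-residue 0 = refl
  χ-residue 1 = refl
  χ-residue 2 = refl
  χ-residue (suc (suc (suc n))) =
    trans (χ-residue n) (cong χ (sym (trans (cong (_% 3) (+-comm 3 n)) ([m+n]%n≡m%n n 3))))

  legendre3≡χ : ∀ n → legendre3 n ≡ χ n
  legendre3≡χ n = trans (by-residue (m%n<n n 3)) (sym (χ-residue n))
    where
    by-residue : n % 3 < 3 → legendre3 n ≡ χ (n % 3)
    by-residue r<3 with n % 3
    by-residue _ | 0 = refl
    by-residue _ | 1 = refl
    by-residue _ | 2 = refl
    by-residue (s≤s (s≤s (s≤s ()))) | suc (suc (suc _))

  alternating-square-sum : ℕ → ℤ
  alternating-square-sum n = Σℤ n (λ k → sign k * (χ (n ∸ k) * χ (n ∸ k)))

  alternating-closed : ℕ → ℤ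
  alternating-closed 0 = + 0
  alternating-closed 1 = + 1
  alternating-closed 2 = + 0
  alternating-closed (suc (suc (suc n))) = alternating-closed n

  peel-first : ∀ n (e : ℤ) (s : ℕ → ℤ) → (∀ k → s (suc k) ≡ e * sign k) →
    Σℤ (suc n) (λ k → s k * (χ (suc n ∸ k) * χ (suc n ∸ k)))
      ≡ s 0 * (χ (suc n) * χ (suc n)) + e * alternating-square-sum n
  peel-first n e s s-suc = begin
    Σℤ (suc n) (λ k → s k * sq (suc n ∸ k))
      ≡⟨ Σℤ-shift n (λ k → s k * sq (suc n ∸ k)) ⟩
    s 0 * sq (suc n) + Σℤ n (λ k → s (suc k) * sq (n ∸ k))
      ≡⟨ cong (λ t → s 0 * sq (suc n) + t) (Σℤ-cong n (λ k _ → trans (cong (_* sq (n ∸ k)) (s-suc k))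
                                                             (reassoc e (sign k) (sq (n ∸ k))))) ⟩
    s 0 * sq (suc n) + Σℤ n (λ k → e * (sign k * sq (n ∸ k)))
      ≡⟨ cong (λ t → s 0 * sq (suc n) + t) (Σℤ-*ˡ n e (λ k → sign k * sq (n ∸ k))) ⟩
    s 0 * sq (suc n) + e * alternating-square-sum n ∎
    where
    sq : ℕ → ℤ
    sq m = χ m * χ m
    reassoc : ∀ x y z → x * y * z ≡ x * (y * z)
    reassoc = solve-∀

  alternating-square-sum-closed : ∀ n → alternating-square-sum n ≡ alternating-closed n
  alternating-square-sum-closed zero = refl
  alternating-square-sum-closed (suc n) = begin
    alternating-square-sum (suc n)
      ≡⟨ peel-first n (- + 1) sign (λ k → neg-as-product (sign k)) ⟩
    + 1 * (χ (suc n) * χ (suc n)) + - + 1 * alternating-square-sum n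
      ≡⟨ cong (λ t → + 1 * (χ (suc n) * χ (suc n)) + - + 1 * t) (alternating-square-sum-closed n) ⟩
    + 1 * (χ (suc n) * χ (suc n)) + - + 1 * alternating-closed n
      ≡⟨ period n ⟩
    alternating-closed (suc n) ∎
    where
    neg-as-product : ∀ x → - x ≡ - + 1 * x
    neg-as-product = solve-∀
    period : ∀ n → + 1 * (χ (suc n) * χ (suc n)) + - + 1 * alternating-closed n ≡ alternating-closed (suc n)
    period 0 = refl
    period 1 = refl
    period 2 = refl
    period (suc (suc (suc n))) = period n

  weighted-square-sum : ∀ n → Σℤ n (λ k → weight k * sign k * (χ (n ∸ k) * χ (n ∸ k))) ≡ χ n
  weighted-square-sum zero = refl
  weighted-square-sum (suc n) = begin
    Σℤ (suc n) (λ k → weight k * sign k * (χ (suc n ∸ k) * χ (suc n ∸ k)))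
      ≡⟨ peel-first n (- + 2) (λ k → weight k * sign k) (λ k → twice-neg (sign k)) ⟩
    + 1 * + 1 * (χ (suc n) * χ (suc n)) + - + 2 * alternating-square-sum n
      ≡⟨ cong (λ t → + 1 * + 1 * (χ (suc n) * χ (suc n)) + - + 2 * t) (alternating-square-sum-closed n) ⟩
    + 1 * + 1 * (χ (suc n) * χ (suc n)) + - + 2 * alternating-closed n
      ≡⟨ period n ⟩
    χ (suc n) ∎
    where
    twice-neg : ∀ x → + 2 * - x ≡ - + 2 * x
    twice-neg = solve-∀
    period : ∀ n → + 1 * + 1 * (χ (suc n) * χ (suc n)) + - + 2 * alternating-closed n ≡ χ (suc n)
    period 0 = refl
    period 1 = refl
    period 2 = refl
    period (suc (suc (suc n))) = period n

module Congruence where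

  open IntegerSums
  open import Data.Nat as ℕ using (ℕ; zero; suc; _<_)
  open import Data.Nat.Properties using (m<n⇒m<1+n; ≤-refl)
  open import Data.Integer using (ℤ; +_; -_; _+_; _*_; _-_; ∣_∣)
  open import Data.Integer.Properties using (abs-*; pos-*; +-identityˡ)
  open import Data.Integer.Divisibility using (_∣_; divides)
  open import Data.Integer.Tactic.RingSolver using (solve-∀)
  open import Relation.Binary.PropositionalEquality

  infix 4 _≡_[mod_]
  record _≡_[mod_] (a b : ℤ) (p : ℕ) : Set where
    constructor by-quotient
    field
      quotient : ℤ
      equation : a ≡ b + quotient * + p

  ≡⇒≡-mod : ∀ {p a b} → a ≡ b → a ≡ b [mod p ]
  ≡⇒≡-mod {p} {a} refl = by-quotient (+ 0) (sym (add-zero-multiple a (+ p)))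
    where
    add-zero-multiple : ∀ a p → a + + 0 * p ≡ a
    add-zero-multiple = solve-∀

  mod-refl : ∀ {p} a → a ≡ a [mod p ]
  mod-refl a = ≡⇒≡-mod refl

  mod-trans : ∀ {p a b d} → a ≡ b [mod p ] → b ≡ d [mod p ] → a ≡ d [mod p ]
  mod-trans {p} {d = d} (by-quotient q refl) (by-quotient r refl) = by-quotient (r + q) (regroup d r q (+ p))
    where
    regroup : ∀ d r q p → d + r * p + q * p ≡ d + (r + q) * p
    regroup = solve-∀

  mod-+ : ∀ {p a b x y} → a ≡ x [mod p ] → b ≡ y [mod p ] → a + b ≡ x + y [mod p ]
  mod-+ {p} {x = x} {y} (by-quotient q refl) (by-quotient r refl) = by-quotient (q + r) (regroup x y q r (+ p))
    where
    regroup : ∀ x y q r p → x + q * p + (y + r * p) ≡ x + y + (q + r) * p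
    regroup = solve-∀

  mod-* : ∀ {p a b x y} → a ≡ x [mod p ] → b ≡ y [mod p ] → a * b ≡ x * y [mod p ]
  mod-* {p} {x = x} {y} (by-quotient q refl) (by-quotient r refl) =
    by-quotient (x * r + q * y + q * r * + p) (expand x y q r (+ p))
    where
    expand : ∀ x y q r p → (x + q * p) * (y + r * p) ≡ x * y + (x * r + q * y + q * r * p) * p
    expand = solve-∀

  mod-three-term : ∀ {p a b d y z} → a + b + d ≡ + 0 [mod p ] → b ≡ y [mod p ] → d ≡ z [mod p ] →
    a ≡ - y - z [mod p ]
  mod-three-term {p} {a} {y = y} {z} (by-quotient q eq) (by-quotient r refl) (by-quotient s refl) =
    by-quotient (q - r - s) (begin
      a                                              ≡⟨ isolate a y z r s P ⟩
      a + (y + r * P) + (z + s * P) - (y + r * P) - (z + s * P) ≡⟨ cong (λ t → t - (y + r * P) - (z + s * P)) eq ⟩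
      + 0 + q * P - (y + r * P) - (z + s * P)        ≡⟨ collect y z q r s P ⟩
      - y - z + (q - r - s) * P                      ∎)
    where
    open ≡-Reasoning
    P : ℤ
    P = + p
    isolate : ∀ a y z r s P → a ≡ a + (y + r * P) + (z + s * P) - (y + r * P) - (z + s * P)
    isolate = solve-∀
    collect : ∀ y z q r s P → + 0 + q * P - (y + r * P) - (z + s * P) ≡ - y - z + (q - r - s) * P
    collect = solve-∀

  mod-Σ : ∀ {p} n (f g : ℕ → ℤ) → (∀ k → k < n → f k ≡ g k [mod p ]) → Σℤ n f ≡ Σℤ n g [mod p ]
  mod-Σ zero f g eq = mod-refl (+ 0)
  mod-Σ (suc n) f g eq = mod-+ (mod-Σ n f g (λ k k<n → eq k (m<n⇒m<1+n k<n))) (eq n ≤-refl)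

  multiple≡0 : ∀ {p} q → + (q ℕ.* p) ≡ + 0 [mod p ]
  multiple≡0 {p} q = by-quotient (+ q) pos-*-as-multiple
    where
    pos-*-as-multiple : + (q ℕ.* p) ≡ + 0 + + q * + p
    pos-*-as-multiple = trans (pos-* q p) (sym (+-identityˡ (+ q * + p)))

  mod⇒∣ : ∀ {p a b} → a ≡ b [mod p ] → + p ∣ a - b
  mod⇒∣ {p} {b = b} (by-quotient q refl) = divides ∣ q ∣ (trans (cong ∣_∣ (cancel b q (+ p))) (abs-* q (+ p)))
    where
    cancel : ∀ b q p → b + q * p - b ≡ q * p
    cancel = solve-∀

module ColumnSums where

  open CentralBinomial
  open CubicCharacter using (χ; χ-recurrence)
  open Congruence
  open import Data.Nat as ℕ using (ℕ; suc; s≤s)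
  open import Data.Nat.Properties using (≤-refl; +-suc; m≤n+m)
  open import Data.Nat.Divisibility using (divides)
  open import Data.Nat.Primality using (Prime)
  open import Data.Integer using (+_; _+_)
  open import Data.Integer.Properties using (pos-+)
  open import Relation.Binary.PropositionalEquality

  -- A(p,k) ≡ χ(p-k) (mod p), stated as: j + k = p implies A(p,k) ≡ χ(j).  Downward in k,
  -- A(p,p) = 0 and A(p,p-1) = 1 start the recursion, and A(p,k) + A(p,k+1) + A(p,k+2) ≡ 0
  -- continues it exactly as χ(j+2) + χ(j+1) + χ(j) = 0.
  column-mod : ∀ p → Prime p → ∀ j k → j ℕ.+ k ≡ p → + column p k ≡ χ j [mod p ]
  column-mod _ _ 0 k refl = ≡⇒≡-mod (cong +_ (column-vanish k k ≤-refl))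
  column-mod _ _ 1 k refl = ≡⇒≡-mod (cong +_ (column-last k))
  column-mod p p-prime (suc (suc j)) k refl =
    subst (λ x → + column p k ≡ x [mod p ]) (sym (χ-recurrence j))
      (mod-three-term three-terms≡0
        (column-mod p p-prime (suc j) (suc k) (cong suc (+-suc j k)))
        (column-mod p p-prime j (suc (suc k)) (trans (+-suc j (suc k)) (cong suc (+-suc j k)))))
    where
    A₀ A₁ A₂ : ℕ
    A₀ = column p k
    A₁ = column p (suc k)
    A₂ = column p (suc (suc k))
    three-terms≡0 : + A₀ + + A₁ + + A₂ ≡ + 0 [mod p ]
    three-terms≡0 with prime-∣-ctr p k p-prime (s≤s (s≤s (m≤n+m k j)))
    ... | divides q ctr≡q*p = mod-trans (≡⇒≡-mod (begin
      + A₀ + + A₁ + + A₂          ≡⟨ cong (_+ + A₂) (pos-+ A₀ A₁) ⟨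
      + (A₀ ℕ.+ A₁) + + A₂        ≡⟨ pos-+ (A₀ ℕ.+ A₁) A₂ ⟨
      + (A₀ ℕ.+ A₁ ℕ.+ A₂)        ≡⟨ cong +_ (column-three-term p k) ⟩
      + ctr p (suc k)             ≡⟨ cong +_ ctr≡q*p ⟩
      + (q ℕ.* p)                 ∎)) (multiple≡0 q)
      where open ≡-Reasoning

module DoubleSum where

  open CentralBinomial using (ctr; column)
  open IntegerSums
  open VonSzily
  open import Data.Nat using (ℕ)
  open import Data.Integer using (ℤ; +_; _*_)
  open import Data.Integer.Properties using (*-assoc)
  open import Relation.Binary.PropositionalEquality
  open ≡-Reasoning

  -- Σ_{i,j<n} S(i,j) = Σ_{k<n} w_k (-1)^k A(n,k)²: von Szily with range n (valid as i < n),
  -- then the triple sum separates.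
  super-catalan-double-sum : ∀ n →
    + Σ< n (λ i → Σ< n (λ j → S i j)) ≡ Σℤ n (λ k → weight k * sign k * (+ column n k * + column n k))
  super-catalan-double-sum n = begin
    + Σ< n (λ i → Σ< n (λ j → S i j))
      ≡⟨ Σℤ-cast n _ ⟩
    Σℤ n (λ i → + Σ< n (λ j → S i j))
      ≡⟨ Σℤ-cong n (λ i i<n → trans (Σℤ-cast n (S i)) (Σℤ-cong n (λ j _ → super-catalan-szily i j n i<n))) ⟩
    Σℤ n (λ i → Σℤ n (λ j → szily n i j))
      ≡⟨ Σℤ-separate n n (λ k → weight k * sign k) (λ i k → + ctr i k) (λ j k → + ctr j k) ⟩
    Σℤ n (λ k → weight k * sign k * Σℤ n (λ i → + ctr i k) * Σℤ n (λ j → + ctr j k))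
      ≡⟨ Σℤ-cong n (λ k _ → cong (λ A → weight k * sign k * A * A) (sym (Σℤ-cast n (λ i → ctr i k)))) ⟩
    Σℤ n (λ k → weight k * sign k * + column n k * + column n k)
      ≡⟨ Σℤ-cong n (λ k _ → *-assoc (weight k * sign k) (+ column n k) (+ column n k)) ⟩
    Σℤ n (λ k → weight k * sign k * (+ column n k * + column n k)) ∎

open import Data.Nat using (ℕ; _∸_)
open import Data.Nat.Primality using (Prime)
open import Data.Integer using (+_; _-_)
open import Data.Integer.Divisibility using (_∣_)
open import Relation.Binary.PropositionalEquality using (_≢_)

theorem1 : (p : ℕ) → Prime p → p ≢ 2 →
    + p ∣ (+ Σ< p (λ i → Σ< p (λ j → S i j)) - legendre3 p)
theorem1 p p-prime _ = mod⇒∣ (subst₂ (λ T L → T ≡ L [mod p ])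
    (sym (super-catalan-double-sum p))
    (trans (weighted-square-sum p) (sym (legendre3≡χ p)))
    (mod-Σ p _ _ λ k k<p →
      let A≡χ = column-mod p p-prime (p ∸ k) k (m∸n+n≡m (<⇒≤ k<p))
      in mod-* (mod-refl (weight k * sign k)) (mod-* A≡χ A≡χ)))
  where
  open Congruence
  open ColumnSums using (column-mod)
  open CubicCharacter using (weighted-square-sum; legendre3≡χ)
  open DoubleSum using (super-catalan-double-sum)
  open VonSzily using (weight; sign)
  open import Data.Integer using (_*_)
  open import Data.Nat.Properties using (m∸n+n≡m; <⇒≤)
  open import Relation.Binary.PropositionalEquality using (subst₂; sym; trans)
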